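{- Let $f:\{0,1\}^n\to\{0,1\}$ be a linear threshold function. Let $\mathcal P$ be a partition of $[n]$ into parts of equal size, and let $\mathcal R_{\mathcal P}$ be the distribution on restrictions $\rho:[n]\to\{0,1,\star\}$ that randomly fixes all but one element of each part of $\mathcal P$. Then \[\Pr_{\rho\sim\mathcal R_{\mathcal P}}[f\text{ is not forced to a constant by }\rho]=O(|\mathcal P|/\sqrt n).\]
   Context: A linear threshold function is one of the form $f(a)=1$ iff $\sum_i w_i a_i\ge t$ for real $w_i,t$. A restriction is a map $\rho:[n]\to\{0,1,\star\}$. A sample from $\mathcal R_{\mathcal P}$ is obtained by choosing uniformly at random one element $e_i$ from each part of $\mathcal P$, setting $\rho(e_i)=\star$, and setting every other coordinate independently and uniformly to $0$ or $1$. A completion of $\rho$ is $\tau:[n]\to\{0,1\}$ agreeing with $\rho$ wherever $\rho\ne\star$. $f$ is forced to a constant by $\rho$ if there is $c\in\{0,1\}$ with $f(\tau)=c$ for all completions $\tau$ of $\rho$. The $O(\cdot)$ hides an absolute constant.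
   Formalization: The weights $w_i$ and the threshold $t$ of the linear threshold function are rational rather than real. -}

module Defs where

open import Data.Nat using (ℕ; zero; suc)
open import Data.Bool using (Bool; true; false)
open import Data.Fin using (Fin)
open import Data.Vec using (Vec; []; _∷_; lookup)
open import Data.List using (List; length)
open import Data.List.Membership.Propositional using (_∈_)
open import Data.List.Relation.Unary.Unique.Propositional using (Unique)
open import Data.Product using (Σ; ∃; _×_; _,_; proj₁; proj₂)
open import Data.Rational using (ℚ; 0ℚ; 1ℚ; _+_; _*_; _≤_)
open import Function.Bundles using (_⇔_; _↔_; Inverse)
open import Relation.Binary.PropositionalEquality using (_≡_)
open import Relation.Nullary using (¬_)

bitℚ : Bool → ℚ
bitℚ true  = 1ℚ
bitℚ false = 0ℚ

dot : ∀ {n} → Vec ℚ n → Vec Bool n → ℚ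
dot []       []       = 0ℚ
dot (w ∷ ws) (a ∷ as) = w * bitℚ a + dot ws as

IsLTF : ∀ {n} → (Vec Bool n → Bool) → Set
IsLTF {n} f = Σ (Vec ℚ n) λ w → Σ ℚ λ t →
  ∀ (a : Vec Bool n) → (f a ≡ true) ⇔ (t ≤ dot w a)

HasSize : ∀ {A : Set} → (A → Set) → ℕ → Set
HasSize {A} P N = Σ (List A) λ L →
  Unique L × (∀ a → (a ∈ L) ⇔ P a) × (length L ≡ N)

-- Partition of [n] into k parts of size m, given by a bijection
-- e : Fin n ↔ Fin k × Fin m (part index, position within the part).
-- A sample of R_P is described by (s , x):
--   s : Vec (Fin m) k  chooses the starred element of each part,
--   x : Vec Bool n     gives the values of the fixed coordinates
--                      (values at starred coordinates are ignored).
module _ {n k m : ℕ} (e : Fin n ↔ (Fin k × Fin m)) where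
  open Inverse e using (to)

  IsStar : Vec (Fin m) k → Fin n → Set
  IsStar s i = proj₂ (to i) ≡ lookup s (proj₁ (to i))

  IsCompletion : Vec (Fin m) k → Vec Bool n → Vec Bool n → Set
  IsCompletion s x τ = ∀ i → ¬ IsStar s i → lookup τ i ≡ lookup x i

  Forced : (Vec Bool n → Bool) → Vec (Fin m) k → Vec Bool n → Set
  Forced f s x = Σ Bool λ c → ∀ τ → IsCompletion s x τ → f τ ≡ c

  NotForced : (Vec Bool n → Bool) → (Vec (Fin m) k × Vec Bool n) → Set
  NotForced f (s , x) = ¬ Forced f s x

module Submission where

-- Write f a = [t ≤ ⟨w, a⟩] and, for a restriction ρ = (s, x), let τ⁺ (τ⁻) be the completion
-- setting each starred coordinate i to [0 ≤ w_i] (to its negation). They maximise (minimise)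
-- ⟨w, ·⟩ over the completions of ρ, so ρ is unforced only if f τ⁻ = 0 and f τ⁺ = 1, and the
-- number N of unforced restrictions is at most Σ_ρ (f τ⁺ − f τ⁻).
-- A vector y is the completion τ^± of exactly 2^k A^±(y) restrictions, where A^±(y) is the
-- product over the parts of the number of positions at which y agrees with the colouring of τ^±.
-- Hence N ≤ 2^k Σ_y |A⁺ − A⁻| and, by Cauchy–Schwarz, N² ≤ 4^k 2^n Σ_y (A⁺ − A⁻)². This sum
-- factorises over the k parts into the first two moments of a binomial distribution:
--   4^k Σ_y (A⁺ − A⁻)² = 2 · 2^n m^k ((m + 1)^k − (m − 1)^k) ≤ 8 k 2^n m^(2k−1)   if 2(k − 1) ≤ m,
-- which gives N² n ≤ 8 k² (m^k 2^n)². If m < 2(k − 1), the trivial bound N ≤ m^k 2^n suffices.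

open import Defs
open import Data.Bool using (Bool; true; false; not)
import Data.Bool.Properties as Bool
open import Data.Fin using (Fin; zero; suc)
import Data.Fin.Properties as Fin
open import Data.List as List using (List; []; _∷_; _++_; length; allFin; cartesianProductWith)
open import Data.List.Properties using (map-tabulate; length-++; length-map; length-tabulate)
open import Data.List.Membership.Propositional using (_∈_)
open import Data.List.Relation.Unary.All using (All; []; _∷_)
open import Data.List.Relation.Unary.AllPairs using ([]; _∷_)
open import Data.List.Relation.Unary.Any using (here; there)
open import Data.List.Relation.Unary.Unique.Propositional using (Unique)
open import Data.Nat using (ℕ; zero; suc; _+_; _*_; _^_; _∸_; _≤_; z≤n; s≤s; ∣_-_∣)
open import Data.Nat.Properties hiding (_≟_)
open import Algebra.Properties.CommutativeSemigroup +-commutativeSemigroup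
  using () renaming (interchange to +-interchange)
open import Algebra.Properties.CommutativeSemigroup *-commutativeSemigroup
  using () renaming (interchange to *-interchange)
open import Data.Nat.Tactic.RingSolver using (solve-∀)
open import Data.Product using (Σ; _×_; _,_; proj₁; proj₂; ∃₂)
import Data.Product.Properties as Product
open import Data.Rational as ℚ using (ℚ; 0ℚ)
import Data.Rational.Properties as ℚ
open import Data.Sum using (_⊎_; inj₁; inj₂)
open import Data.Vec using (Vec; []; _∷_; lookup; map; tabulate; _[_]≔_)
import Data.Vec.Properties as Vec
open import Data.Vec.Relation.Binary.Pointwise.Extensional using (ext; Pointwise-≡⇒≡)
open import Function using (_∘_; const)
open import Function.Bundles using (_↔_; Inverse; Equivalence; mk↔ₛ′)
open import Relation.Binary.Definitions using (DecidableEquality)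
open import Relation.Binary.PropositionalEquality
  using (_≡_; _≢_; refl; sym; trans; cong; cong₂; subst; subst₂; module ≡-Reasoning)
open import Relation.Nullary using (Dec; yes; no; does; contradiction)

private
  variable
    A B C : Set

-- Finite sums over enumerated types

bit : Bool → ℕ
bit true  = 1
bit false = 0

∑ : List A → (A → ℕ) → ℕ
∑ []       F = 0
∑ (a ∷ as) F = F a + ∑ as F

infix 2 ∑
syntax ∑ L (λ a → F) = ∑[ a ∈ L ] F

∑-cong : ∀ (L : List A) {F G : A → ℕ} → (∀ a → F a ≡ G a) → ∑ L F ≡ ∑ L G
∑-cong []      F≗G = refl
∑-cong (a ∷ L) F≗G = cong₂ _+_ (F≗G a) (∑-cong L F≗G)

∑-mono : ∀ (L : List A) {F G : A → ℕ} → (∀ a → F a ≤ G a) → ∑ L F ≤ ∑ L G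
∑-mono []      F≤G = z≤n
∑-mono (a ∷ L) F≤G = +-mono-≤ (F≤G a) (∑-mono L F≤G)

∑-distrib-+ : ∀ (L : List A) (F G : A → ℕ) → (∑[ a ∈ L ] F a + G a) ≡ ∑ L F + ∑ L G
∑-distrib-+ []      F G = refl
∑-distrib-+ (a ∷ L) F G rewrite ∑-distrib-+ L F G = +-interchange (F a) (G a) (∑ L F) (∑ L G)

∑-*ˡ : ∀ (L : List A) c (F : A → ℕ) → (∑[ a ∈ L ] c * F a) ≡ c * ∑ L F
∑-*ˡ []      c F = sym (*-zeroʳ c)
∑-*ˡ (a ∷ L) c F rewrite ∑-*ˡ L c F = sym (*-distribˡ-+ c (F a) (∑ L F))

∑-*ʳ : ∀ (L : List A) c (F : A → ℕ) → (∑[ a ∈ L ] F a * c) ≡ ∑ L F * c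
∑-*ʳ L c F = trans (∑-cong L (λ a → *-comm (F a) c)) (trans (∑-*ˡ L c F) (*-comm c (∑ L F)))

∑-const : ∀ (L : List A) c → ∑ L (const c) ≡ length L * c
∑-const []      c = refl
∑-const (a ∷ L) c = cong (c +_) (∑-const L c)

∑-++ : ∀ (L M : List A) (F : A → ℕ) → ∑ (L ++ M) F ≡ ∑ L F + ∑ M F
∑-++ []      M F = refl
∑-++ (a ∷ L) M F rewrite ∑-++ L M F = sym (+-assoc (F a) (∑ L F) (∑ M F))

∑-affine : ∀ (L : List A) c x (F G : A → ℕ) →
           (∑[ a ∈ L ] c + x * F a + G a) ≡ length L * c + x * ∑ L F + ∑ L G
∑-affine []      c x F G = sym (cong (_+ 0) (*-zeroʳ x))
∑-affine (a ∷ L) c x F G rewrite ∑-affine L c x F G =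
  regroup c x (F a) (G a) (length L) (∑ L F) (∑ L G)
  where
    regroup : ∀ c x f g l S T →
              (c + x * f + g) + (l * c + x * S + T) ≡ suc l * c + x * (f + S) + (g + T)
    regroup = solve-∀

∑-map : ∀ (f : A → B) (L : List A) (F : B → ℕ) → ∑ (List.map f L) F ≡ ∑ L (F ∘ f)
∑-map f []      F = refl
∑-map f (a ∷ L) F = cong (F (f a) +_) (∑-map f L F)

∑-comm : ∀ (L : List A) (M : List B) (F : A → B → ℕ) →
         (∑[ a ∈ L ] ∑[ b ∈ M ] F a b) ≡ (∑[ b ∈ M ] ∑[ a ∈ L ] F a b)
∑-comm []      M F = sym (trans (∑-const M 0) (*-zeroʳ (length M)))
∑-comm (a ∷ L) M F rewrite ∑-comm L M F = sym (∑-distrib-+ M (F a) (λ b → ∑[ a ∈ L ] F a b))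

∑-cartesianProductWith : ∀ (g : A → B → C) (L : List A) (M : List B) (F : C → ℕ) →
                         ∑ (cartesianProductWith g L M) F ≡ (∑[ a ∈ L ] ∑[ b ∈ M ] F (g a b))
∑-cartesianProductWith g []      M F = refl
∑-cartesianProductWith g (a ∷ L) M F = begin
  ∑ (List.map (g a) M ++ cartesianProductWith g L M) F
    ≡⟨ ∑-++ (List.map (g a) M) _ F ⟩
  ∑ (List.map (g a) M) F + ∑ (cartesianProductWith g L M) F
    ≡⟨ cong₂ _+_ (∑-map (g a) M F) (∑-cartesianProductWith g L M F) ⟩
  (∑[ b ∈ M ] F (g a b)) + (∑[ a ∈ L ] ∑[ b ∈ M ] F (g a b)) ∎
  where open ≡-Reasoning

length-cartesianProductWith : ∀ (g : A → B → C) (L : List A) (M : List B) →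
                              length (cartesianProductWith g L M) ≡ length L * length M
length-cartesianProductWith g []      M = refl
length-cartesianProductWith g (a ∷ L) M = begin
  length (List.map (g a) M ++ cartesianProductWith g L M)
    ≡⟨ length-++ (List.map (g a) M) ⟩
  length (List.map (g a) M) + length (cartesianProductWith g L M)
    ≡⟨ cong₂ _+_ (length-map (g a) M) (length-cartesianProductWith g L M) ⟩
  length M + length L * length M ∎
  where open ≡-Reasoning

module _ (_≟_ : DecidableEquality A) where

  δ : A → A → ℕ
  δ a b = bit (does (a ≟ b))

  δ-refl : ∀ a → δ a a ≡ 1
  δ-refl a with a ≟ a
  ... | yes _  = refl
  ... | no a≢a = contradiction refl a≢a

  δ-≢ : ∀ {a b} → a ≢ b → δ a b ≡ 0
  δ-≢ {a} {b} a≢b with a ≟ b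
  ... | yes a≡b = contradiction a≡b a≢b
  ... | no _    = refl

  δ-sym : ∀ a b → δ a b ≡ δ b a
  δ-sym a b with a ≟ b
  ... | yes refl = sym (δ-refl a)
  ... | no a≢b   = sym (δ-≢ (a≢b ∘ sym))

  δ-*-subst : ∀ a b (G : A → ℕ) → δ a b * G b ≡ δ a b * G a
  δ-*-subst a b G with a ≟ b
  ... | yes refl = refl
  ... | no _     = refl

δ-injective₂ : (_≟A_ : DecidableEquality A) (_≟B_ : DecidableEquality B) (_≟C_ : DecidableEquality C)
               (g : A → B → C) → (∀ {a a' b b'} → g a b ≡ g a' b' → a ≡ a' × b ≡ b') →
               ∀ a a' b b' → δ _≟C_ (g a b) (g a' b') ≡ δ _≟A_ a a' * δ _≟B_ b b'
δ-injective₂ _≟A_ _≟B_ _≟C_ g g-inj a a' b b' with a ≟A a' | b ≟B b'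
... | yes refl | yes refl = δ-refl _≟C_ (g a b)
... | yes refl | no b≢b'  = δ-≢ _≟C_ (b≢b' ∘ proj₂ ∘ g-inj)
... | no a≢a'  | _        = δ-≢ _≟C_ (a≢a' ∘ proj₁ ∘ g-inj)

record Enumeration (A : Set) : Set where
  field
    elements    : List A
    _≟_         : DecidableEquality A
    occurs-once : ∀ a → (∑[ b ∈ elements ] δ _≟_ a b) ≡ 1

open Enumeration public

module _ (E : Enumeration A) where

  ∑-δ : ∀ a (G : A → ℕ) → (∑[ b ∈ elements E ] δ (_≟_ E) a b * G b) ≡ G a
  ∑-δ a G = begin
    (∑[ b ∈ elements E ] δ (_≟_ E) a b * G b)
      ≡⟨ ∑-cong (elements E) (λ b → δ-*-subst (_≟_ E) a b G) ⟩
    (∑[ b ∈ elements E ] δ (_≟_ E) a b * G a)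
      ≡⟨ ∑-*ʳ (elements E) (G a) _ ⟩
    (∑[ b ∈ elements E ] δ (_≟_ E) a b) * G a
      ≡⟨ cong (_* G a) (occurs-once E a) ⟩
    1 * G a
      ≡⟨ *-identityˡ (G a) ⟩
    G a ∎
    where open ≡-Reasoning

  occurs-once′ : ∀ a → (∑[ b ∈ elements E ] δ (_≟_ E) b a) ≡ 1
  occurs-once′ a = trans (∑-cong (elements E) (λ b → δ-sym (_≟_ E) b a)) (occurs-once E a)

  private
    ∑-δ-absent : ∀ {a} (L : List A) → All (a ≢_) L → ∑ L (δ (_≟_ E) a) ≡ 0
    ∑-δ-absent []      []          = refl
    ∑-δ-absent (b ∷ L) (a≢b ∷ a∉L) = cong₂ _+_ (δ-≢ (_≟_ E) a≢b) (∑-δ-absent L a∉L)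

    ∑-δ-unique : (L : List A) → Unique L → (Q : A → ℕ) → (∀ b → b ∈ L → 1 ≤ Q b) →
                 ∀ a → ∑ L (δ (_≟_ E) a) ≤ Q a
    ∑-δ-unique []      _              Q Q≥1 a = z≤n
    ∑-δ-unique (b ∷ L) (b∉L ∷ L-uniq) Q Q≥1 a with (_≟_ E) a b
    ... | yes refl rewrite ∑-δ-absent L b∉L = Q≥1 a (here refl)
    ... | no _     = ∑-δ-unique L L-uniq Q (λ c c∈L → Q≥1 c (there c∈L)) a

  length-unique≤∑ : (L : List A) → Unique L → (Q : A → ℕ) → (∀ b → b ∈ L → 1 ≤ Q b) →
                    length L ≤ ∑ (elements E) Q
  length-unique≤∑ L L-uniq Q Q≥1 = begin
    length L
      ≡⟨ sym (*-identityʳ (length L)) ⟩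
    length L * 1
      ≡⟨ sym (∑-const L 1) ⟩
    ∑ L (const 1)
      ≡⟨ ∑-cong L (λ b → sym (occurs-once′ b)) ⟩
    (∑[ b ∈ L ] ∑[ a ∈ elements E ] δ (_≟_ E) a b)
      ≡⟨ ∑-comm L (elements E) _ ⟩
    (∑[ a ∈ elements E ] ∑ L (δ (_≟_ E) a))
      ≤⟨ ∑-mono (elements E) (∑-δ-unique L L-uniq Q Q≥1) ⟩
    ∑ (elements E) Q ∎
    where open ≤-Reasoning

∑-↔ : (EA : Enumeration A) (EB : Enumeration B) (A↔B : A ↔ B) (F : B → ℕ) →
      ∑ (elements EB) F ≡ ∑ (elements EA) (F ∘ Inverse.to A↔B)
∑-↔ EA EB A↔B F = sym (begin
  (∑[ a ∈ elements EA ] F (to a))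
    ≡⟨ ∑-cong (elements EA) (λ a → sym (∑-δ EB (to a) F)) ⟩
  (∑[ a ∈ elements EA ] ∑[ b ∈ elements EB ] δB (to a) b * F b)
    ≡⟨ ∑-comm (elements EA) (elements EB) _ ⟩
  (∑[ b ∈ elements EB ] ∑[ a ∈ elements EA ] δB (to a) b * F b)
    ≡⟨ ∑-cong (elements EB) (λ b → ∑-*ʳ (elements EA) (F b) _) ⟩
  (∑[ b ∈ elements EB ] (∑[ a ∈ elements EA ] δB (to a) b) * F b)
    ≡⟨ ∑-cong (elements EB) (λ b → cong (_* F b) (counted-once b)) ⟩
  (∑[ b ∈ elements EB ] 1 * F b)
    ≡⟨ ∑-cong (elements EB) (λ b → *-identityˡ (F b)) ⟩
  ∑ (elements EB) F ∎)
  where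
    open ≡-Reasoning
    open Inverse A↔B using (to; from; strictlyInverseˡ; strictlyInverseʳ)
    δA = δ (_≟_ EA)
    δB = δ (_≟_ EB)

    δ-transport : ∀ a b → δB (to a) b ≡ δA a (from b)
    δ-transport a b with _≟_ EB (to a) b
    ... | yes refl rewrite strictlyInverseʳ a = sym (δ-refl (_≟_ EA) a)
    ... | no to-a≢b =
      sym (δ-≢ (_≟_ EA) λ a≡from-b → to-a≢b (trans (cong to a≡from-b) (strictlyInverseˡ b)))

    counted-once : ∀ b → (∑[ a ∈ elements EA ] δB (to a) b) ≡ 1
    counted-once b = trans (∑-cong (elements EA) (λ a → δ-transport a b)) (occurs-once′ EA (from b))

length-↔ : (EA : Enumeration A) (EB : Enumeration B) → A ↔ B →
           length (elements EA) ≡ length (elements EB)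
length-↔ EA EB A↔B = begin
  length (elements EA)                  ≡⟨ sym (*-identityʳ _) ⟩
  length (elements EA) * 1              ≡⟨ sym (∑-const (elements EA) 1) ⟩
  ∑ (elements EA) (const 1)             ≡⟨ sym (∑-↔ EA EB A↔B (const 1)) ⟩
  ∑ (elements EB) (const 1)             ≡⟨ ∑-const (elements EB) 1 ⟩
  length (elements EB) * 1              ≡⟨ *-identityʳ _ ⟩
  length (elements EB)                  ∎
  where open ≡-Reasoning

pairing-enumeration : (g : A → B → C) → (∀ {a a' b b'} → g a b ≡ g a' b' → a ≡ a' × b ≡ b') →
                      (∀ c → ∃₂ λ a b → g a b ≡ c) → DecidableEquality C →
                      Enumeration A → Enumeration B → Enumeration C
pairing-enumeration g g-inj g-surj _≟C_ EA EB = record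
  { elements    = cartesianProductWith g (elements EA) (elements EB)
  ; _≟_         = _≟C_
  ; occurs-once = λ c → once c (g-surj c)
  }
  where
    once : ∀ c → (∃₂ λ a b → g a b ≡ c) →
           (∑[ c' ∈ cartesianProductWith g (elements EA) (elements EB) ] δ _≟C_ c c') ≡ 1
    once c (a , b , refl) = begin
      (∑[ c' ∈ cartesianProductWith g (elements EA) (elements EB) ] δ _≟C_ (g a b) c')
        ≡⟨ ∑-cartesianProductWith g (elements EA) (elements EB) _ ⟩
      (∑[ a' ∈ elements EA ] ∑[ b' ∈ elements EB ] δ _≟C_ (g a b) (g a' b'))
        ≡⟨ ∑-cong (elements EA) (λ a' → ∑-cong (elements EB) λ b' →
             δ-injective₂ (_≟_ EA) (_≟_ EB) _≟C_ g g-inj a a' b b') ⟩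
      (∑[ a' ∈ elements EA ] ∑[ b' ∈ elements EB ] δ (_≟_ EA) a a' * δ (_≟_ EB) b b')
        ≡⟨ ∑-cong (elements EA) (λ a' → ∑-*ˡ (elements EB) (δ (_≟_ EA) a a') (δ (_≟_ EB) b)) ⟩
      (∑[ a' ∈ elements EA ] δ (_≟_ EA) a a' * (∑[ b' ∈ elements EB ] δ (_≟_ EB) b b'))
        ≡⟨ ∑-δ EA a _ ⟩
      (∑[ b' ∈ elements EB ] δ (_≟_ EB) b b')
        ≡⟨ occurs-once EB b ⟩
      1 ∎
      where open ≡-Reasoning

bools : Enumeration Bool
bools = record { elements = false ∷ true ∷ [] ; _≟_ = Bool._≟_ ; occurs-once = once }
  where
    once : ∀ a → (∑[ b ∈ false ∷ true ∷ [] ] δ Bool._≟_ a b) ≡ 1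
    once false = refl
    once true  = refl

∑-allFin-suc : ∀ m (F : Fin (suc m) → ℕ) → ∑ (allFin (suc m)) F ≡ F zero + ∑ (allFin m) (F ∘ suc)
∑-allFin-suc m F = cong (F zero +_) (begin
  ∑ (List.tabulate suc) F             ≡⟨ cong (λ L → ∑ L F) (sym (map-tabulate (λ i → i) suc)) ⟩
  ∑ (List.map suc (allFin m)) F       ≡⟨ ∑-map suc (allFin m) F ⟩
  ∑ (allFin m) (F ∘ suc)              ∎)
  where open ≡-Reasoning

fins : ∀ m → Enumeration (Fin m)
fins m = record { elements = allFin m ; _≟_ = Fin._≟_ ; occurs-once = once }
  where
    once : ∀ {m} (i : Fin m) → (∑[ j ∈ allFin m ] δ Fin._≟_ i j) ≡ 1
    once {suc m} zero = begin
      (∑[ j ∈ allFin (suc m) ] δ Fin._≟_ zero j)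
        ≡⟨ ∑-allFin-suc m (δ Fin._≟_ zero) ⟩
      1 + (∑[ j ∈ allFin m ] δ Fin._≟_ zero (suc j))
        ≡⟨ cong suc (∑-cong (allFin m) (λ j → δ-≢ Fin._≟_ {zero} {suc j} λ ())) ⟩
      1 + ∑ (allFin m) (const 0)
        ≡⟨ cong suc (trans (∑-const (allFin m) 0) (*-zeroʳ (length (allFin m)))) ⟩
      1 ∎
      where open ≡-Reasoning
    once {suc m} (suc i) = begin
      (∑[ j ∈ allFin (suc m) ] δ Fin._≟_ (suc i) j)
        ≡⟨ ∑-allFin-suc m (δ Fin._≟_ (suc i)) ⟩
      0 + (∑[ j ∈ allFin m ] δ Fin._≟_ (suc i) (suc j))
        ≡⟨ ∑-cong (allFin m) (λ j → δ-suc i j) ⟩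
      (∑[ j ∈ allFin m ] δ Fin._≟_ i j)
        ≡⟨ once i ⟩
      1 ∎
      where
        open ≡-Reasoning
        δ-suc : ∀ {m} (i j : Fin m) → δ Fin._≟_ (suc i) (suc j) ≡ δ Fin._≟_ i j
        δ-suc i j with i Fin.≟ j
        ... | yes _ = refl
        ... | no _  = refl

vecs : Enumeration A → ∀ k → Enumeration (Vec A k)
vecs E zero    = record
  { elements = [] ∷ [] ; _≟_ = Vec.≡-dec (_≟_ E) ; occurs-once = λ { [] → refl } }
vecs E (suc k) = pairing-enumeration _∷_ Vec.∷-injective (λ { (a ∷ v) → a , v , refl })
                   (Vec.≡-dec (_≟_ E)) E (vecs E k)

pairs : Enumeration A → Enumeration B → Enumeration (A × B)
pairs EA EB = pairing-enumeration _,_ Product.,-injective (λ (a , b) → a , b , refl)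
                (Product.≡-dec (_≟_ EA) (_≟_ EB)) EA EB

length-vecs : ∀ (E : Enumeration A) k → length (elements (vecs E k)) ≡ length (elements E) ^ k
length-vecs E zero    = refl
length-vecs E (suc k) = trans (length-cartesianProductWith _∷_ (elements E) (elements (vecs E k)))
                              (cong (length (elements E) *_) (length-vecs E k))

^-distribʳ-* : ∀ a b k → (a * b) ^ k ≡ a ^ k * b ^ k
^-distribʳ-* a b zero    = refl
^-distribʳ-* a b (suc k) = trans (cong (a * b *_) (^-distribʳ-* a b k)) (*-interchange a b (a ^ k) (b ^ k))

∣m-n∣²+2mn≡m²+n² : ∀ m n → ∣ m - n ∣ * ∣ m - n ∣ + 2 * (m * n) ≡ m * m + n * n
∣m-n∣²+2mn≡m²+n² zero    n       = left-zero n
  where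
    left-zero : ∀ n → n * n + 2 * (0 * n) ≡ 0 * 0 + n * n
    left-zero = solve-∀
∣m-n∣²+2mn≡m²+n² (suc m) zero    = right-zero m
  where
    right-zero : ∀ m → suc m * suc m + 2 * (suc m * 0) ≡ suc m * suc m + 0 * 0
    right-zero = solve-∀
∣m-n∣²+2mn≡m²+n² (suc m) (suc n) = begin
  ∣ m - n ∣ * ∣ m - n ∣ + 2 * (suc m * suc n)
    ≡⟨ split-off ∣ m - n ∣ m n ⟩
  (∣ m - n ∣ * ∣ m - n ∣ + 2 * (m * n)) + (2 * m + 2 * n + 2)
    ≡⟨ cong (_+ (2 * m + 2 * n + 2)) (∣m-n∣²+2mn≡m²+n² m n) ⟩
  (m * m + n * n) + (2 * m + 2 * n + 2)
    ≡⟨ merge m n ⟩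
  suc m * suc m + suc n * suc n ∎
  where
    open ≡-Reasoning
    split-off : ∀ d m n → d * d + 2 * (suc m * suc n) ≡ (d * d + 2 * (m * n)) + (2 * m + 2 * n + 2)
    split-off = solve-∀
    merge : ∀ m n → (m * m + n * n) + (2 * m + 2 * n + 2) ≡ suc m * suc m + suc n * suc n
    merge = solve-∀

2mn≤m²+n² : ∀ m n → 2 * (m * n) ≤ m * m + n * n
2mn≤m²+n² m n =
  subst (2 * (m * n) ≤_) (∣m-n∣²+2mn≡m²+n² m n) (m≤n+m (2 * (m * n)) (∣ m - n ∣ * ∣ m - n ∣))

private
  cross-term≤ : ∀ (L : List A) f c → 2 * c * ∑ L f ≤ length L * (c * c) + (∑[ a ∈ L ] f a * f a)
  cross-term≤ []      f c = ≤-reflexive (*-zeroʳ (2 * c))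
  cross-term≤ (a ∷ L) f c = begin
    2 * c * (f a + S)
      ≡⟨ distrib c (f a) S ⟩
    2 * (c * f a) + 2 * c * S
      ≤⟨ +-mono-≤ (2mn≤m²+n² c (f a)) (cross-term≤ L f c) ⟩
    (c * c + f a * f a) + (length L * (c * c) + Q)
      ≡⟨ regroup c (f a) (length L) Q ⟩
    suc (length L) * (c * c) + (f a * f a + Q) ∎
    where
      open ≤-Reasoning
      S = ∑ L f
      Q = ∑[ a ∈ L ] f a * f a
      distrib : ∀ c x S → 2 * c * (x + S) ≡ 2 * (c * x) + 2 * c * S
      distrib = solve-∀
      regroup : ∀ c x l Q → (c * c + x * x) + (l * (c * c) + Q) ≡ suc l * (c * c) + (x * x + Q)
      regroup = solve-∀

∑-Cauchy-Schwarz : ∀ (L : List A) f → ∑ L f * ∑ L f ≤ length L * (∑[ a ∈ L ] f a * f a)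
∑-Cauchy-Schwarz []      f = z≤n
∑-Cauchy-Schwarz (a ∷ L) f = begin
  (x + S) * (x + S)
    ≡⟨ expand x S ⟩
  x * x + 2 * x * S + S * S
    ≤⟨ +-mono-≤ (+-monoʳ-≤ (x * x) (cross-term≤ L f x)) (∑-Cauchy-Schwarz L f) ⟩
  x * x + (l * (x * x) + Q) + l * Q
    ≡⟨ regroup x l Q ⟩
  suc l * (x * x + Q) ∎
  where
    open ≤-Reasoning
    x = f a
    S = ∑ L f
    Q = ∑[ a ∈ L ] f a * f a
    l = length L
    expand : ∀ x S → (x + S) * (x + S) ≡ x * x + 2 * x * S + S * S
    expand = solve-∀
    regroup : ∀ x l Q → x * x + (l * (x * x) + Q) + l * Q ≡ suc l * (x * x + Q)
    regroup = solve-∀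

m*bit≤n*bit+∣m-n∣ : ∀ m n b → m * bit b ≤ n * bit b + ∣ m - n ∣
m*bit≤n*bit+∣m-n∣ m n false = subst (_≤ n * 0 + ∣ m - n ∣) (sym (*-zeroʳ m)) z≤n
m*bit≤n*bit+∣m-n∣ m n true  =
  subst₂ (λ x y → x ≤ y + ∣ m - n ∣) (sym (*-identityʳ m)) (sym (*-identityʳ n)) (m≤n+∣m-n∣ m n)

pow-mean-value : ∀ y d j → (y + d) ^ suc j ≤ y ^ suc j + suc j * d * (y + d) ^ j
pow-mean-value y d zero    = ≤-reflexive (base y d)
  where
    base : ∀ y d → (y + d) * 1 ≡ y * 1 + 1 * d * 1
    base = solve-∀
pow-mean-value y d (suc j) = begin
  (y + d) * ((y + d) * X)
    ≤⟨ *-monoʳ-≤ (y + d) (pow-mean-value y d j) ⟩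
  (y + d) * (y * Z + suc j * d * X)
    ≡⟨ expand y d Z j X ⟩
  y * (y * Z) + d * (y * Z) + suc j * d * ((y + d) * X)
    ≤⟨ +-monoˡ-≤ _ (+-monoʳ-≤ (y * (y * Z)) (*-monoʳ-≤ d y^suc-j≤)) ⟩
  y * (y * Z) + d * ((y + d) * X) + suc j * d * ((y + d) * X)
    ≡⟨ collect y d Z j X ⟩
  y * (y * Z) + suc (suc j) * d * ((y + d) * X) ∎
  where
    open ≤-Reasoning
    X = (y + d) ^ j
    Z = y ^ j
    y^suc-j≤ : y * Z ≤ (y + d) * X
    y^suc-j≤ = ^-monoˡ-≤ (suc j) (m≤m+n y d)
    expand : ∀ y d Z j X →
             (y + d) * (y * Z + suc j * d * X) ≡ y * (y * Z) + d * (y * Z) + suc j * d * ((y + d) * X)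
    expand = solve-∀
    collect : ∀ y d Z j X → y * (y * Z) + d * ((y + d) * X) + suc j * d * ((y + d) * X)
                            ≡ y * (y * Z) + suc (suc j) * d * ((y + d) * X)
    collect = solve-∀

private
  suc-pow*≤pow : ∀ a j b → b + j ≤ a → suc a ^ j * b ≤ a ^ suc j
  suc-pow*≤pow a zero    b b+0≤a = begin
    1 * b   ≡⟨ *-identityˡ b ⟩
    b       ≡⟨ sym (+-identityʳ b) ⟩
    b + 0   ≤⟨ b+0≤a ⟩
    a       ≡⟨ sym (*-identityʳ a) ⟩
    a * 1   ∎
    where open ≤-Reasoning
  suc-pow*≤pow a (suc j) b b+1+j≤a = begin
    suc a * suc a ^ j * b
      ≡⟨ rearrange a (suc a ^ j) b ⟩
    suc a ^ j * (b + a * b)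
      ≤⟨ *-monoʳ-≤ (suc a ^ j) (+-monoˡ-≤ (a * b) b≤a) ⟩
    suc a ^ j * (a + a * b)
      ≡⟨ rearrange′ (suc a ^ j) a b ⟩
    a * (suc a ^ j * suc b)
      ≤⟨ *-monoʳ-≤ a (suc-pow*≤pow a j (suc b) (subst (_≤ a) (+-suc b j) b+1+j≤a)) ⟩
    a * a ^ suc j ∎
    where
      open ≤-Reasoning
      rearrange : ∀ a y b → suc a * y * b ≡ y * (b + a * b)
      rearrange = solve-∀
      rearrange′ : ∀ x a b → x * (a + a * b) ≡ a * (x * suc b)
      rearrange′ = solve-∀
      b≤a : b ≤ a
      b≤a = ≤-trans (m≤m+n b (suc j)) b+1+j≤a

suc-pow≤2*pow : ∀ a j → 2 * j ≤ a → suc a ^ j ≤ 2 * a ^ j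
suc-pow≤2*pow zero      zero _    = s≤s z≤n
suc-pow≤2*pow a@(suc _) j    2j≤a with m≤n⇒∃[o]m+o≡n 2j≤a
... | r , 2j+r≡a = *-cancelʳ-≤ (suc a ^ j) (2 * a ^ j) a (begin
  suc a ^ j * a               ≤⟨ *-monoʳ-≤ (suc a ^ j) a≤2b ⟩
  suc a ^ j * (2 * b)         ≡⟨ rearrange (suc a ^ j) b ⟩
  2 * (suc a ^ j * b)         ≤⟨ *-monoʳ-≤ 2 (suc-pow*≤pow a j b b+j≤a) ⟩
  2 * (a * a ^ j)             ≡⟨ rearrange′ a (a ^ j) ⟩
  2 * a ^ j * a               ∎)
  where
    open ≤-Reasoning
    b = j + r
    b+j≤a : b + j ≤ a
    b+j≤a = ≤-reflexive (trans (+-comm-shuffle j r) 2j+r≡a)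
      where
        +-comm-shuffle : ∀ j r → (j + r) + j ≡ 2 * j + r
        +-comm-shuffle = solve-∀
    a≤2b : a ≤ 2 * b
    a≤2b = subst (_≤ 2 * b) 2j+r≡a (subst (2 * j + r ≤_) (sym (double j r)) (m≤m+n (2 * j + r) r))
      where
        double : ∀ j r → 2 * (j + r) ≡ 2 * j + r + r
        double = solve-∀
    rearrange : ∀ x b → x * (2 * b) ≡ 2 * (x * b)
    rearrange = solve-∀
    rearrange′ : ∀ a x → 2 * (a * x) ≡ 2 * x * a
    rearrange′ = solve-∀

pow-gap : ∀ m j → 2 * j ≤ suc m → suc (suc m) ^ suc j ≤ m ^ suc j + 4 * suc j * suc m ^ j
pow-gap m j 2j≤1+m = begin
  suc (suc m) ^ suc j
    ≡⟨ cong (_^ suc j) (+-comm 2 m) ⟩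
  (m + 2) ^ suc j
    ≤⟨ pow-mean-value m 2 j ⟩
  m ^ suc j + suc j * 2 * (m + 2) ^ j
    ≡⟨ cong (λ a → m ^ suc j + suc j * 2 * a ^ j) (+-comm m 2) ⟩
  m ^ suc j + suc j * 2 * suc (suc m) ^ j
    ≤⟨ +-monoʳ-≤ (m ^ suc j) (*-monoʳ-≤ (suc j * 2) (suc-pow≤2*pow (suc m) j 2j≤1+m)) ⟩
  m ^ suc j + suc j * 2 * (2 * suc m ^ j)
    ≡⟨ cong (m ^ suc j +_) (regroup (suc j) (suc m ^ j)) ⟩
  m ^ suc j + 4 * suc j * suc m ^ j ∎
  where
    open ≤-Reasoning
    regroup : ∀ k x → k * 2 * (2 * x) ≡ 4 * k * x
    regroup = solve-∀

-- Agreements between bit vectors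

𝔹 : List Bool
𝔹 = elements bools

bitVecs : ∀ m → List (Vec Bool m)
bitVecs m = elements (vecs bools m)

δᴮ : Bool → Bool → ℕ
δᴮ = δ Bool._≟_

∑-bitVecs-suc : ∀ m (F : Vec Bool (suc m) → ℕ) →
                ∑ (bitVecs (suc m)) F ≡ (∑[ a ∈ 𝔹 ] ∑[ u ∈ bitVecs m ] F (a ∷ u))
∑-bitVecs-suc m = ∑-cartesianProductWith _∷_ 𝔹 (bitVecs m)

∑-bitVecs-const : ∀ m c → ∑ (bitVecs m) (const c) ≡ 2 ^ m * c
∑-bitVecs-const m c = trans (∑-const (bitVecs m) c) (cong (_* c) (length-vecs bools m))

∑-𝔹-δ : ∀ {m} b (G : ℕ → Vec Bool m → ℕ) →
        (∑[ a ∈ 𝔹 ] ∑[ u ∈ bitVecs m ] G (δᴮ b a) u) ≡ ∑ (bitVecs m) (G 1) + ∑ (bitVecs m) (G 0)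
∑-𝔹-δ {m} false G = cong (∑ (bitVecs m) (G 1) +_) (+-identityʳ (∑ (bitVecs m) (G 0)))
∑-𝔹-δ {m} true  G = trans (cong (∑ (bitVecs m) (G 0) +_) (+-identityʳ (∑ (bitVecs m) (G 1))))
                          (+-comm (∑ (bitVecs m) (G 0)) (∑ (bitVecs m) (G 1)))

agreements : ∀ {m} → Vec Bool m → Vec Bool m → ℕ
agreements []      []      = 0
agreements (b ∷ d) (a ∷ u) = δᴮ b a + agreements d u

agreements-as-∑ : ∀ {m} (d u : Vec Bool m) →
                  agreements d u ≡ (∑[ p ∈ allFin m ] δᴮ (lookup d p) (lookup u p))
agreements-as-∑ []      []      = refl
agreements-as-∑ {suc m} (b ∷ d) (a ∷ u) =
  sym (trans (∑-allFin-suc m (λ p → δᴮ (lookup (b ∷ d) p) (lookup (a ∷ u) p)))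
             (cong (δᴮ b a +_) (sym (agreements-as-∑ d u))))

agreements+agreements-not : ∀ {m} (d u : Vec Bool m) → agreements d u + agreements (map not d) u ≡ m
agreements+agreements-not []      []      = refl
agreements+agreements-not (b ∷ d) (a ∷ u) = begin
  (δᴮ b a + agreements d u) + (δᴮ (not b) a + agreements (map not d) u)
    ≡⟨ +-interchange (δᴮ b a) _ _ _ ⟩
  (δᴮ b a + δᴮ (not b) a) + (agreements d u + agreements (map not d) u)
    ≡⟨ cong₂ _+_ (δ+δ-not b a) (agreements+agreements-not d u) ⟩
  suc _ ∎
  where
    open ≡-Reasoning
    δ+δ-not : ∀ b a → δᴮ b a + δᴮ (not b) a ≡ 1
    δ+δ-not false false = refl
    δ+δ-not false true  = refl
    δ+δ-not true  false = refl
    δ+δ-not true  true  = refl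

∑-update : ∀ {m} (p : Fin m) b (H : Vec Bool m → ℕ) →
           (∑[ u ∈ bitVecs m ] H (u [ p ]≔ b)) ≡ 2 * (∑[ u ∈ bitVecs m ] δᴮ b (lookup u p) * H u)
∑-update {suc m} zero b H = begin
  (∑[ u ∈ bitVecs (suc m) ] H (u [ zero ]≔ b))
    ≡⟨ ∑-bitVecs-suc m _ ⟩
  (∑[ a ∈ 𝔹 ] ∑[ u ∈ bitVecs m ] H (b ∷ u))
    ≡⟨ ∑-const 𝔹 (∑[ u ∈ bitVecs m ] H (b ∷ u)) ⟩
  2 * (∑[ u ∈ bitVecs m ] H (b ∷ u))
    ≡⟨ cong (2 *_) (sym (∑-δ bools b (λ a → ∑[ u ∈ bitVecs m ] H (a ∷ u)))) ⟩
  2 * (∑[ a ∈ 𝔹 ] δᴮ b a * (∑[ u ∈ bitVecs m ] H (a ∷ u)))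
    ≡⟨ cong (2 *_) (∑-cong 𝔹 λ a → sym (∑-*ˡ (bitVecs m) (δᴮ b a) (H ∘ (a ∷_)))) ⟩
  2 * (∑[ a ∈ 𝔹 ] ∑[ u ∈ bitVecs m ] δᴮ b a * H (a ∷ u))
    ≡⟨ cong (2 *_) (sym (∑-bitVecs-suc m _)) ⟩
  2 * (∑[ u ∈ bitVecs (suc m) ] δᴮ b (lookup u zero) * H u) ∎
  where open ≡-Reasoning
∑-update {suc m} (suc p) b H = begin
  (∑[ u ∈ bitVecs (suc m) ] H (u [ suc p ]≔ b))
    ≡⟨ ∑-bitVecs-suc m _ ⟩
  (∑[ a ∈ 𝔹 ] ∑[ u ∈ bitVecs m ] H (a ∷ (u [ p ]≔ b)))
    ≡⟨ ∑-cong 𝔹 (λ a → ∑-update p b (H ∘ (a ∷_))) ⟩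
  (∑[ a ∈ 𝔹 ] 2 * (∑[ u ∈ bitVecs m ] δᴮ b (lookup u p) * H (a ∷ u)))
    ≡⟨ ∑-*ˡ 𝔹 2 (λ a → ∑[ u ∈ bitVecs m ] δᴮ b (lookup u p) * H (a ∷ u)) ⟩
  2 * (∑[ a ∈ 𝔹 ] ∑[ u ∈ bitVecs m ] δᴮ b (lookup u p) * H (a ∷ u))
    ≡⟨ cong (2 *_) (sym (∑-bitVecs-suc m _)) ⟩
  2 * (∑[ u ∈ bitVecs (suc m) ] δᴮ b (lookup u (suc p)) * H u) ∎
  where open ≡-Reasoning

∑-update-agreements : ∀ {m} (d : Vec Bool m) (H : Vec Bool m → ℕ) →
  (∑[ p ∈ allFin m ] ∑[ u ∈ bitVecs m ] H (u [ p ]≔ lookup d p)) ≡ 2 * (∑[ u ∈ bitVecs m ] agreements d u * H u)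
∑-update-agreements {m} d H = begin
  (∑[ p ∈ allFin m ] ∑[ u ∈ bitVecs m ] H (u [ p ]≔ lookup d p))
    ≡⟨ ∑-cong (allFin m) (λ p → ∑-update p (lookup d p) H) ⟩
  (∑[ p ∈ allFin m ] 2 * (∑[ u ∈ bitVecs m ] δ-at p u * H u))
    ≡⟨ ∑-*ˡ (allFin m) 2 _ ⟩
  2 * (∑[ p ∈ allFin m ] ∑[ u ∈ bitVecs m ] δ-at p u * H u)
    ≡⟨ cong (2 *_) (∑-comm (allFin m) (bitVecs m) _) ⟩
  2 * (∑[ u ∈ bitVecs m ] ∑[ p ∈ allFin m ] δ-at p u * H u)
    ≡⟨ cong (2 *_) (∑-cong (bitVecs m) λ u → ∑-*ʳ (allFin m) (H u) _) ⟩
  2 * (∑[ u ∈ bitVecs m ] (∑[ p ∈ allFin m ] δ-at p u) * H u)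
    ≡⟨ cong (2 *_) (∑-cong (bitVecs m) λ u → cong (_* H u) (sym (agreements-as-∑ d u))) ⟩
  2 * (∑[ u ∈ bitVecs m ] agreements d u * H u) ∎
  where
    open ≡-Reasoning
    δ-at : Fin m → Vec Bool m → ℕ
    δ-at p u = δᴮ (lookup d p) (lookup u p)

first-moment : ∀ {m} (d : Vec Bool m) → 2 * ∑ (bitVecs m) (agreements d) ≡ m * 2 ^ m
first-moment []              = refl
first-moment {suc m} (b ∷ d) = begin
  2 * ∑ (bitVecs (suc m)) (agreements (b ∷ d))
    ≡⟨ cong (2 *_) (trans (∑-bitVecs-suc m _) (∑-𝔹-δ b (λ x u → x + agreements d u))) ⟩
  2 * ((∑[ u ∈ bitVecs m ] 1 + α u) + S)
    ≡⟨ cong (λ x → 2 * (x + S))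
            (trans (∑-distrib-+ (bitVecs m) (const 1) α) (cong (_+ S) (∑-bitVecs-const m 1))) ⟩
  2 * ((P * 1 + S) + S)
    ≡⟨ regroup P S ⟩
  2 * P + 2 * (2 * S)
    ≡⟨ cong (λ x → 2 * P + 2 * x) (first-moment d) ⟩
  2 * P + 2 * (m * P)
    ≡⟨ collect m P ⟩
  suc m * (2 * P) ∎
  where
    open ≡-Reasoning
    α = agreements d
    S = ∑ (bitVecs m) α
    P = 2 ^ m
    regroup : ∀ P S → 2 * ((P * 1 + S) + S) ≡ 2 * P + 2 * (2 * S)
    regroup = solve-∀
    collect : ∀ m P → 2 * P + 2 * (m * P) ≡ suc m * (2 * P)
    collect = solve-∀

second-moment : ∀ {m} (d : Vec Bool m) →
                4 * (∑[ u ∈ bitVecs m ] agreements d u * agreements d u) ≡ 2 ^ m * (m * suc m)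
second-moment []              = refl
second-moment {suc m} (b ∷ d) = begin
  4 * (∑[ u ∈ bitVecs (suc m) ] agreements (b ∷ d) u * agreements (b ∷ d) u)
    ≡⟨ cong (4 *_) (trans (∑-bitVecs-suc m _) (∑-𝔹-δ b (λ x u → (x + α u) * (x + α u)))) ⟩
  4 * ((∑[ u ∈ bitVecs m ] (1 + α u) * (1 + α u)) + S₂)
    ≡⟨ cong (λ x → 4 * (x + S₂)) (trans (∑-cong (bitVecs m) λ u → square-suc (α u))
                                         (∑-affine (bitVecs m) 1 2 α (λ u → α u * α u))) ⟩
  4 * ((length (bitVecs m) * 1 + 2 * S₁ + S₂) + S₂)
    ≡⟨ cong (λ l → 4 * ((l * 1 + 2 * S₁ + S₂) + S₂)) (length-vecs bools m) ⟩
  4 * ((P * 1 + 2 * S₁ + S₂) + S₂)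
    ≡⟨ regroup P S₁ S₂ ⟩
  4 * P + 4 * (2 * S₁) + 2 * (4 * S₂)
    ≡⟨ cong₂ (λ x y → 4 * P + 4 * x + 2 * y) (first-moment d) (second-moment d) ⟩
  4 * P + 4 * (m * P) + 2 * (P * (m * suc m))
    ≡⟨ collect m P ⟩
  2 * P * (suc m * suc (suc m)) ∎
  where
    open ≡-Reasoning
    α = agreements d
    S₁ = ∑ (bitVecs m) α
    S₂ = ∑[ u ∈ bitVecs m ] α u * α u
    P = 2 ^ m
    square-suc : ∀ a → (1 + a) * (1 + a) ≡ 1 + 2 * a + a * a
    square-suc = solve-∀
    regroup : ∀ P S₁ S₂ → 4 * ((P * 1 + 2 * S₁ + S₂) + S₂) ≡ 4 * P + 4 * (2 * S₁) + 2 * (4 * S₂)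
    regroup = solve-∀
    collect : ∀ m P → 4 * P + 4 * (m * P) + 2 * (P * (m * suc m)) ≡ 2 * P * (suc m * suc (suc m))
    collect = solve-∀

cross-moment : ∀ {m} (d : Vec Bool (suc m)) →
  4 * (∑[ u ∈ bitVecs (suc m) ] agreements d u * agreements (map not d) u) ≡ 2 ^ suc m * (suc m * m)
cross-moment {m} d =
  +-cancelʳ-≡ (2 ^ M * (M * suc M)) (4 * (∑[ u ∈ bitVecs M ] α u * ᾱ u)) (2 ^ M * (M * m)) (begin
  4 * (∑[ u ∈ bitVecs M ] α u * ᾱ u) + 2 ^ M * (M * suc M)
    ≡⟨ cong (4 * (∑[ u ∈ bitVecs M ] α u * ᾱ u) +_) (sym (second-moment d)) ⟩
  4 * (∑[ u ∈ bitVecs M ] α u * ᾱ u) + 4 * (∑[ u ∈ bitVecs M ] α u * α u)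
    ≡⟨ sym (*-distribˡ-+ 4 (∑[ u ∈ bitVecs M ] α u * ᾱ u) _) ⟩
  4 * ((∑[ u ∈ bitVecs M ] α u * ᾱ u) + (∑[ u ∈ bitVecs M ] α u * α u))
    ≡⟨ cong (4 *_) (sym (∑-distrib-+ (bitVecs M) _ _)) ⟩
  4 * (∑[ u ∈ bitVecs M ] α u * ᾱ u + α u * α u)
    ≡⟨ cong (4 *_) (∑-cong (bitVecs M) λ u → α*ᾱ+α*α u) ⟩
  4 * (∑[ u ∈ bitVecs M ] M * α u)
    ≡⟨ cong (4 *_) (∑-*ˡ (bitVecs M) M α) ⟩
  4 * (M * ∑ (bitVecs M) α)
    ≡⟨ regroup M (∑ (bitVecs M) α) ⟩
  2 * M * (2 * ∑ (bitVecs M) α)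
    ≡⟨ cong (2 * M *_) (first-moment d) ⟩
  2 * M * (M * 2 ^ M)
    ≡⟨ collect m (2 ^ M) ⟩
  2 ^ M * (M * m) + 2 ^ M * (M * suc M) ∎)
  where
    open ≡-Reasoning
    M = suc m
    α = agreements d
    ᾱ = agreements (map not d)
    α*ᾱ+α*α : ∀ u → α u * ᾱ u + α u * α u ≡ M * α u
    α*ᾱ+α*α u = begin
      α u * ᾱ u + α u * α u
        ≡⟨ sym (*-distribˡ-+ (α u) (ᾱ u) (α u)) ⟩
      α u * (ᾱ u + α u)
        ≡⟨ cong (α u *_) (trans (+-comm (ᾱ u) (α u)) (agreements+agreements-not d u)) ⟩
      α u * M
        ≡⟨ *-comm (α u) M ⟩
      M * α u ∎
    regroup : ∀ M S → 4 * (M * S) ≡ 2 * M * (2 * S)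
    regroup = solve-∀
    collect : ∀ m P → 2 * suc m * (suc m * P) ≡ P * (suc m * m) + P * (suc m * suc (suc m))
    collect = solve-∀

-- Blockwise products

blockProduct : ∀ {k} → (A → B → ℕ) → Vec A k → Vec B k → ℕ
blockProduct h []       []       = 1
blockProduct h (d ∷ ds) (y ∷ ys) = h d y * blockProduct h ds ys

blockProduct-* : ∀ {k} (h g : A → B → ℕ) (ds : Vec A k) (ys : Vec B k) →
                 blockProduct h ds ys * blockProduct g ds ys ≡ blockProduct (λ d y → h d y * g d y) ds ys
blockProduct-* h g []       []       = refl
blockProduct-* h g (d ∷ ds) (y ∷ ys) =
  trans (*-interchange (h d y) _ (g d y) _) (cong (h d y * g d y *_) (blockProduct-* h g ds ys))

blockProduct-map : ∀ {k} (h : B → C → ℕ) (f : A → B) (ds : Vec A k) (ys : Vec C k) →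
                   blockProduct h (map f ds) ys ≡ blockProduct (h ∘ f) ds ys
blockProduct-map h f []       []       = refl
blockProduct-map h f (d ∷ ds) (y ∷ ys) = cong (h (f d) y *_) (blockProduct-map h f ds ys)

∑-blockProduct : (E : Enumeration B) (h : A → B → ℕ) (c K : ℕ) → (∀ d → c * ∑ (elements E) (h d) ≡ K) →
                 ∀ {k} (ds : Vec A k) → c ^ k * ∑ (elements (vecs E k)) (blockProduct h ds) ≡ K ^ k
∑-blockProduct E h c K c*∑≡K []       = refl
∑-blockProduct E h c K c*∑≡K {suc k} (d ∷ ds) = begin
  c ^ suc k * ∑ (elements (vecs E (suc k))) (blockProduct h (d ∷ ds))
    ≡⟨ cong (c ^ suc k *_) (∑-cartesianProductWith _∷_ (elements E) (elements (vecs E k)) _) ⟩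
  c ^ suc k * (∑[ y ∈ elements E ] ∑[ ys ∈ elements (vecs E k) ] h d y * blockProduct h ds ys)
    ≡⟨ cong (c ^ suc k *_) (∑-cong (elements E) λ y → ∑-*ˡ (elements (vecs E k)) (h d y) (blockProduct h ds)) ⟩
  c ^ suc k * (∑[ y ∈ elements E ] h d y * Rest)
    ≡⟨ cong (c ^ suc k *_) (∑-*ʳ (elements E) Rest (h d)) ⟩
  c ^ suc k * (∑ (elements E) (h d) * Rest)
    ≡⟨ *-interchange c (c ^ k) (∑ (elements E) (h d)) Rest ⟩
  (c * ∑ (elements E) (h d)) * (c ^ k * Rest)
    ≡⟨ cong₂ _*_ (c*∑≡K d) (∑-blockProduct E h c K c*∑≡K ds) ⟩
  K * K ^ k ∎
  where
    open ≡-Reasoning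
    Rest = ∑ (elements (vecs E k)) (blockProduct h ds)

module _ {m : ℕ} where

  overwriteBlocks : ∀ {k} → Vec (Vec Bool m) k → Vec (Fin m) k → Vec (Vec Bool m) k → Vec (Vec Bool m) k
  overwriteBlocks []       []       []       = []
  overwriteBlocks (d ∷ ds) (s ∷ ss) (y ∷ ys) = (y [ s ]≔ lookup d s) ∷ overwriteBlocks ds ss ys

  stars : ∀ k → List (Vec (Fin m) k)
  stars k = elements (vecs (fins m) k)

  blocks : ∀ k → List (Vec (Vec Bool m) k)
  blocks k = elements (vecs (vecs bools m) k)

  length-blocks : ∀ k → length (blocks k) ≡ (2 ^ m) ^ k
  length-blocks k = trans (length-vecs (vecs bools m) k) (cong (_^ k) (length-vecs bools m))

  ∑-overwriteBlocks : ∀ {k} (ds : Vec (Vec Bool m) k) (G : Vec (Vec Bool m) k → ℕ) →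
    (∑[ ss ∈ stars k ] ∑[ ys ∈ blocks k ] G (overwriteBlocks ds ss ys))
      ≡ 2 ^ k * (∑[ ys ∈ blocks k ] blockProduct agreements ds ys * G ys)
  ∑-overwriteBlocks []       G = unit (G [])
    where
      unit : ∀ g → (g + 0) + 0 ≡ 1 * (1 * g + 0)
      unit = solve-∀
  ∑-overwriteBlocks {suc k} (d ∷ ds) G = begin
    (∑[ ss ∈ stars (suc k) ] ∑[ ys ∈ blocks (suc k) ] G (overwriteBlocks (d ∷ ds) ss ys))
      ≡⟨ ∑-cartesianProductWith _∷_ (allFin m) (stars k) _ ⟩
    (∑[ s ∈ allFin m ] ∑[ ss ∈ stars k ] ∑[ ys ∈ blocks (suc k) ] G (overwriteBlocks (d ∷ ds) (s ∷ ss) ys))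
      ≡⟨ ∑-cong (allFin m) (λ s → ∑-cong (stars k) λ ss → ∑-cartesianProductWith _∷_ (bitVecs m) (blocks k) _) ⟩
    (∑[ s ∈ allFin m ] ∑[ ss ∈ stars k ] ∑[ y ∈ bitVecs m ] ∑[ ys ∈ blocks k ] G (set s y ∷ overwriteBlocks ds ss ys))
      ≡⟨ ∑-cong (allFin m) (λ s → ∑-comm (stars k) (bitVecs m) _) ⟩
    (∑[ s ∈ allFin m ] ∑[ y ∈ bitVecs m ] ∑[ ss ∈ stars k ] ∑[ ys ∈ blocks k ] G (set s y ∷ overwriteBlocks ds ss ys))
      ≡⟨ ∑-cong (allFin m) (λ s → ∑-cong (bitVecs m) λ y → ∑-overwriteBlocks ds (G ∘ (set s y ∷_))) ⟩
    (∑[ s ∈ allFin m ] ∑[ y ∈ bitVecs m ] 2 ^ k * K (set s y))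
      ≡⟨ ∑-cong (allFin m) (λ s → ∑-*ˡ (bitVecs m) (2 ^ k) (K ∘ set s)) ⟩
    (∑[ s ∈ allFin m ] 2 ^ k * (∑[ y ∈ bitVecs m ] K (set s y)))
      ≡⟨ ∑-*ˡ (allFin m) (2 ^ k) _ ⟩
    2 ^ k * (∑[ s ∈ allFin m ] ∑[ y ∈ bitVecs m ] K (set s y))
      ≡⟨ cong (2 ^ k *_) (∑-update-agreements d K) ⟩
    2 ^ k * (2 * (∑[ y ∈ bitVecs m ] agreements d y * K y))
      ≡⟨ sym (*-assoc (2 ^ k) 2 _) ⟩
    2 ^ k * 2 * (∑[ y ∈ bitVecs m ] agreements d y * K y)
      ≡⟨ cong₂ _*_ (*-comm (2 ^ k) 2) (∑-cong (bitVecs m) λ y → sym (∑-*ˡ (blocks k) (agreements d y) _)) ⟩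
    2 ^ suc k * (∑[ y ∈ bitVecs m ] ∑[ ys ∈ blocks k ] agreements d y * (blockProduct agreements ds ys * G (y ∷ ys)))
      ≡⟨ cong (2 ^ suc k *_) (∑-cong (bitVecs m) λ y → ∑-cong (blocks k) λ ys → sym (*-assoc (agreements d y) _ _)) ⟩
    2 ^ suc k * (∑[ y ∈ bitVecs m ] ∑[ ys ∈ blocks k ] blockProduct agreements (d ∷ ds) (y ∷ ys) * G (y ∷ ys))
      ≡⟨ cong (2 ^ suc k *_) (sym (∑-cartesianProductWith _∷_ (bitVecs m) (blocks k) _)) ⟩
    2 ^ suc k * (∑[ ys ∈ blocks (suc k) ] blockProduct agreements (d ∷ ds) ys * G ys) ∎
    where
      open ≡-Reasoning
      set : Fin m → Vec Bool m → Vec Bool m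
      set s y = y [ s ]≔ lookup d s
      K : Vec Bool m → ℕ
      K y = ∑[ ys ∈ blocks k ] blockProduct agreements ds ys * G (y ∷ ys)

  lookup-overwriteBlocks-star : ∀ {k} (ds : Vec (Vec Bool m) k) ss ys j {p} → p ≡ lookup ss j →
    lookup (lookup (overwriteBlocks ds ss ys) j) p ≡ lookup (lookup ds j) p
  lookup-overwriteBlocks-star (d ∷ ds) (s ∷ ss) (y ∷ ys) zero    refl = Vec.lookup∘update s y (lookup d s)
  lookup-overwriteBlocks-star (d ∷ ds) (s ∷ ss) (y ∷ ys) (suc j) p≡s = lookup-overwriteBlocks-star ds ss ys j p≡s

  lookup-overwriteBlocks-nonstar : ∀ {k} (ds : Vec (Vec Bool m) k) ss ys j {p} → p ≢ lookup ss j →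
    lookup (lookup (overwriteBlocks ds ss ys) j) p ≡ lookup (lookup ys j) p
  lookup-overwriteBlocks-nonstar (d ∷ ds) (s ∷ ss) (y ∷ ys) zero    p≢s = Vec.lookup∘update′ p≢s y (lookup d s)
  lookup-overwriteBlocks-nonstar (d ∷ ds) (s ∷ ss) (y ∷ ys) (suc j) p≢s = lookup-overwriteBlocks-nonstar ds ss ys j p≢s

-- A⁺ ds y counts the star choices under which y agrees with ds at every starred position;
-- A⁻ ds y does the same for the complementary colouring.
module _ {m k : ℕ} (ds : Vec (Vec Bool m) k) where

  A⁺ A⁻ : Vec (Vec Bool m) k → ℕ
  A⁺ = blockProduct agreements ds
  A⁻ = blockProduct agreements (map (map not) ds)

module _ {m k : ℕ} (ds : Vec (Vec Bool (suc m)) k) where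

  private
    M = suc m

    4^k*∑-blockProduct : ∀ (h : Vec Bool M → Vec Bool M → ℕ) K → (∀ d → 4 * ∑ (bitVecs M) (h d) ≡ K) →
                         4 ^ k * ∑ (blocks k) (blockProduct h ds) ≡ K ^ k
    4^k*∑-blockProduct h K hyp = ∑-blockProduct (vecs bools M) h 4 K hyp ds

    A⁻-as-blockProduct : ∀ ys → A⁻ ds ys ≡ blockProduct (agreements ∘ map not) ds ys
    A⁻-as-blockProduct = blockProduct-map agreements (map not) ds

    ∑A⁺A⁺ : 4 ^ k * (∑[ ys ∈ blocks k ] A⁺ ds ys * A⁺ ds ys) ≡ (2 ^ M * (M * suc M)) ^ k
    ∑A⁺A⁺ = trans (cong (4 ^ k *_) (∑-cong (blocks k) λ ys → blockProduct-* agreements agreements ds ys))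
                  (4^k*∑-blockProduct _ _ second-moment)

    ∑A⁻A⁻ : 4 ^ k * (∑[ ys ∈ blocks k ] A⁻ ds ys * A⁻ ds ys) ≡ (2 ^ M * (M * suc M)) ^ k
    ∑A⁻A⁻ = trans (cong (4 ^ k *_) (∑-cong (blocks k) λ ys →
                    trans (cong₂ _*_ (A⁻-as-blockProduct ys) (A⁻-as-blockProduct ys)) (blockProduct-* _ _ ds ys)))
                  (4^k*∑-blockProduct _ _ (second-moment ∘ map not))

    ∑A⁺A⁻ : 4 ^ k * (∑[ ys ∈ blocks k ] A⁺ ds ys * A⁻ ds ys) ≡ (2 ^ M * (M * m)) ^ k
    ∑A⁺A⁻ = trans (cong (4 ^ k *_) (∑-cong (blocks k) λ ys →
                    trans (cong (A⁺ ds ys *_) (A⁻-as-blockProduct ys)) (blockProduct-* _ _ ds ys)))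
                  (4^k*∑-blockProduct _ _ cross-moment)

  ∑-blockProduct-gap² :
    4 ^ k * (∑[ ys ∈ blocks k ] ∣ A⁺ ds ys - A⁻ ds ys ∣ * ∣ A⁺ ds ys - A⁻ ds ys ∣) + 2 * (2 ^ M * (M * m)) ^ k
      ≡ 2 * (2 ^ M * (M * suc M)) ^ k
  ∑-blockProduct-gap² = begin
    4 ^ k * ∑ (blocks k) Δ² + 2 * (2 ^ M * (M * m)) ^ k
      ≡⟨ cong (λ x → 4 ^ k * ∑ (blocks k) Δ² + 2 * x) (sym ∑A⁺A⁻) ⟩
    4 ^ k * ∑ (blocks k) Δ² + 2 * (4 ^ k * (∑[ ys ∈ blocks k ] A⁺ ds ys * A⁻ ds ys))
      ≡⟨ factor (4 ^ k) (∑ (blocks k) Δ²) _ ⟩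
    4 ^ k * (∑ (blocks k) Δ² + 2 * (∑[ ys ∈ blocks k ] A⁺ ds ys * A⁻ ds ys))
      ≡⟨ cong (λ x → 4 ^ k * (∑ (blocks k) Δ² + x)) (sym (∑-*ˡ (blocks k) 2 _)) ⟩
    4 ^ k * (∑ (blocks k) Δ² + (∑[ ys ∈ blocks k ] 2 * (A⁺ ds ys * A⁻ ds ys)))
      ≡⟨ cong (4 ^ k *_) (sym (∑-distrib-+ (blocks k) Δ² _)) ⟩
    4 ^ k * (∑[ ys ∈ blocks k ] Δ² ys + 2 * (A⁺ ds ys * A⁻ ds ys))
      ≡⟨ cong (4 ^ k *_) (∑-cong (blocks k) λ ys → ∣m-n∣²+2mn≡m²+n² (A⁺ ds ys) (A⁻ ds ys)) ⟩
    4 ^ k * (∑[ ys ∈ blocks k ] A⁺ ds ys * A⁺ ds ys + A⁻ ds ys * A⁻ ds ys)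
      ≡⟨ cong (4 ^ k *_) (∑-distrib-+ (blocks k) _ _) ⟩
    4 ^ k * ((∑[ ys ∈ blocks k ] A⁺ ds ys * A⁺ ds ys) + (∑[ ys ∈ blocks k ] A⁻ ds ys * A⁻ ds ys))
      ≡⟨ *-distribˡ-+ (4 ^ k) _ _ ⟩
    4 ^ k * (∑[ ys ∈ blocks k ] A⁺ ds ys * A⁺ ds ys) + 4 ^ k * (∑[ ys ∈ blocks k ] A⁻ ds ys * A⁻ ds ys)
      ≡⟨ cong₂ _+_ ∑A⁺A⁺ ∑A⁻A⁻ ⟩
    K ^ k + K ^ k
      ≡⟨ cong (K ^ k +_) (sym (+-identityʳ (K ^ k))) ⟩
    2 * K ^ k ∎
    where
      open ≡-Reasoning
      K = 2 ^ M * (M * suc M)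
      Δ² : Vec (Vec Bool M) k → ℕ
      Δ² ys = ∣ A⁺ ds ys - A⁻ ds ys ∣ * ∣ A⁺ ds ys - A⁻ ds ys ∣
      factor : ∀ c x y → c * x + 2 * (c * y) ≡ c * (x + 2 * y)
      factor = solve-∀

-- Cutting vectors into the parts of a partition

module _ {n k m : ℕ} (e : Fin n ↔ (Fin k × Fin m)) where
  open Inverse e using (to; from; strictlyInverseˡ; strictlyInverseʳ)

  n≡k*m : n ≡ k * m
  n≡k*m = begin
    n
      ≡⟨ sym (length-tabulate {n = n} (λ i → i)) ⟩
    length (allFin n)
      ≡⟨ length-↔ (fins n) (pairs (fins k) (fins m)) e ⟩
    length (elements (pairs (fins k) (fins m)))
      ≡⟨ length-cartesianProductWith _,_ (allFin k) (allFin m) ⟩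
    length (allFin k) * length (allFin m)
      ≡⟨ cong₂ _*_ (length-tabulate {n = k} (λ i → i)) (length-tabulate {n = m} (λ i → i)) ⟩
    k * m ∎
    where open ≡-Reasoning

  toBlocks : Vec A n → Vec (Vec A m) k
  toBlocks x = tabulate λ j → tabulate λ p → lookup x (from (j , p))

  fromBlocks : Vec (Vec A m) k → Vec A n
  fromBlocks y = tabulate λ i → lookup (lookup y (proj₁ (to i))) (proj₂ (to i))

  lookup-toBlocks : ∀ (x : Vec A n) j p → lookup (lookup (toBlocks x) j) p ≡ lookup x (from (j , p))
  lookup-toBlocks x j p = trans (cong (λ v → lookup v p) (Vec.lookup∘tabulate _ j)) (Vec.lookup∘tabulate _ p)

  lookup-fromBlocks : ∀ (y : Vec (Vec A m) k) i →
                      lookup (fromBlocks y) i ≡ lookup (lookup y (proj₁ (to i))) (proj₂ (to i))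
  lookup-fromBlocks y = Vec.lookup∘tabulate _

  toBlocks∘fromBlocks : ∀ (y : Vec (Vec A m) k) → toBlocks (fromBlocks y) ≡ y
  toBlocks∘fromBlocks y = Pointwise-≡⇒≡ (ext λ j → Pointwise-≡⇒≡ (ext λ p → begin
    lookup (lookup (toBlocks (fromBlocks y)) j) p
      ≡⟨ lookup-toBlocks (fromBlocks y) j p ⟩
    lookup (fromBlocks y) (from (j , p))
      ≡⟨ lookup-fromBlocks y (from (j , p)) ⟩
    lookup (lookup y (proj₁ (to (from (j , p))))) (proj₂ (to (from (j , p))))
      ≡⟨ cong (λ (j′ , p′) → lookup (lookup y j′) p′) (strictlyInverseˡ (j , p)) ⟩
    lookup (lookup y j) p ∎))
    where open ≡-Reasoning

  fromBlocks∘toBlocks : ∀ (x : Vec A n) → fromBlocks (toBlocks x) ≡ x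
  fromBlocks∘toBlocks x = Pointwise-≡⇒≡ (ext λ i → begin
    lookup (fromBlocks (toBlocks x)) i
      ≡⟨ lookup-fromBlocks (toBlocks x) i ⟩
    lookup (lookup (toBlocks x) (proj₁ (to i))) (proj₂ (to i))
      ≡⟨ lookup-toBlocks x (proj₁ (to i)) (proj₂ (to i)) ⟩
    lookup x (from (to i))
      ≡⟨ cong (lookup x) (strictlyInverseʳ i) ⟩
    lookup x i ∎)
    where open ≡-Reasoning

  blocks↔ : Vec (Vec A m) k ↔ Vec A n
  blocks↔ = mk↔ₛ′ fromBlocks toBlocks fromBlocks∘toBlocks toBlocks∘fromBlocks

  toBlocks-map : ∀ (f : A → B) (x : Vec A n) → toBlocks (map f x) ≡ map (map f) (toBlocks x)
  toBlocks-map f x = Pointwise-≡⇒≡ (ext λ j → Pointwise-≡⇒≡ (ext λ p → begin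
    lookup (lookup (toBlocks (map f x)) j) p
      ≡⟨ lookup-toBlocks (map f x) j p ⟩
    lookup (map f x) (from (j , p))
      ≡⟨ Vec.lookup-map (from (j , p)) f x ⟩
    f (lookup x (from (j , p)))
      ≡⟨ cong f (sym (lookup-toBlocks x j p)) ⟩
    f (lookup (lookup (toBlocks x) j) p)
      ≡⟨ sym (Vec.lookup-map p f (lookup (toBlocks x) j)) ⟩
    lookup (map f (lookup (toBlocks x) j)) p
      ≡⟨ cong (λ v → lookup v p) (sym (Vec.lookup-map j (map f) (toBlocks x))) ⟩
    lookup (lookup (map (map f) (toBlocks x)) j) p ∎))
    where open ≡-Reasoning

  2^n≡[2^m]^k : 2 ^ n ≡ (2 ^ m) ^ k
  2^n≡[2^m]^k = begin
    2 ^ n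
      ≡⟨ sym (length-vecs bools n) ⟩
    length (bitVecs n)
      ≡⟨ sym (length-↔ (vecs (vecs bools m) k) (vecs bools n) blocks↔) ⟩
    length (blocks k)
      ≡⟨ length-blocks k ⟩
    (2 ^ m) ^ k ∎
    where open ≡-Reasoning

  fill : Vec Bool n → Vec (Fin m) k → Vec Bool n → Vec Bool n
  fill c s x = fromBlocks (overwriteBlocks (toBlocks c) s (toBlocks x))

  fill-star : ∀ c s x {i} → IsStar e s i → lookup (fill c s x) i ≡ lookup c i
  fill-star c s x {i} star = begin
    lookup (fill c s x) i
      ≡⟨ lookup-fromBlocks (overwriteBlocks (toBlocks c) s (toBlocks x)) i ⟩
    lookup (lookup (overwriteBlocks (toBlocks c) s (toBlocks x)) (proj₁ (to i))) (proj₂ (to i))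
      ≡⟨ lookup-overwriteBlocks-star (toBlocks c) s (toBlocks x) (proj₁ (to i)) star ⟩
    lookup (lookup (toBlocks c) (proj₁ (to i))) (proj₂ (to i))
      ≡⟨ lookup-toBlocks c (proj₁ (to i)) (proj₂ (to i)) ⟩
    lookup c (from (to i))
      ≡⟨ cong (lookup c) (strictlyInverseʳ i) ⟩
    lookup c i ∎
    where open ≡-Reasoning

  fill-isCompletion : ∀ c s x → IsCompletion e s x (fill c s x)
  fill-isCompletion c s x i nonstar = begin
    lookup (fill c s x) i
      ≡⟨ lookup-fromBlocks (overwriteBlocks (toBlocks c) s (toBlocks x)) i ⟩
    lookup (lookup (overwriteBlocks (toBlocks c) s (toBlocks x)) (proj₁ (to i))) (proj₂ (to i))
      ≡⟨ lookup-overwriteBlocks-nonstar (toBlocks c) s (toBlocks x) (proj₁ (to i)) nonstar ⟩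
    lookup (lookup (toBlocks x) (proj₁ (to i))) (proj₂ (to i))
      ≡⟨ lookup-toBlocks x (proj₁ (to i)) (proj₂ (to i)) ⟩
    lookup x (from (to i))
      ≡⟨ cong (lookup x) (strictlyInverseʳ i) ⟩
    lookup x i ∎
    where open ≡-Reasoning

  ∑-fill : ∀ c (G : Vec Bool n → ℕ) →
    (∑[ s ∈ stars k ] ∑[ x ∈ bitVecs n ] G (fill c s x))
      ≡ 2 ^ k * (∑[ y ∈ blocks k ] blockProduct agreements (toBlocks c) y * G (fromBlocks y))
  ∑-fill c G = begin
    (∑[ s ∈ stars k ] ∑[ x ∈ bitVecs n ] G (fill c s x))
      ≡⟨ ∑-cong (stars k) (λ s → ∑-↔ (vecs (vecs bools m) k) (vecs bools n) blocks↔ (G ∘ fill c s)) ⟩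
    (∑[ s ∈ stars k ] ∑[ y ∈ blocks k ] G (fill c s (fromBlocks y)))
      ≡⟨ ∑-cong (stars k) (λ s → ∑-cong (blocks k) λ y →
          cong (λ y′ → G (fromBlocks (overwriteBlocks (toBlocks c) s y′))) (toBlocks∘fromBlocks y)) ⟩
    (∑[ s ∈ stars k ] ∑[ y ∈ blocks k ] G (fromBlocks (overwriteBlocks (toBlocks c) s y)))
      ≡⟨ ∑-overwriteBlocks (toBlocks c) (G ∘ fromBlocks) ⟩
    2 ^ k * (∑[ y ∈ blocks k ] blockProduct agreements (toBlocks c) y * G (fromBlocks y)) ∎
    where open ≡-Reasoning

-- Extremal completions under a linear threshold function

dot-mono : ∀ {n} (w : Vec ℚ n) {a b : Vec Bool n} →
           (∀ i → lookup w i ℚ.* bitℚ (lookup a i) ℚ.≤ lookup w i ℚ.* bitℚ (lookup b i)) →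
           dot w a ℚ.≤ dot w b
dot-mono []       {[]}    {[]}    _      = ℚ.≤-refl
dot-mono (w ∷ ws) {a ∷ as} {b ∷ bs} term≤ = ℚ.+-mono-≤ (term≤ zero) (dot-mono ws (term≤ ∘ suc))

argmax : ℚ → Bool
argmax q = does (0ℚ ℚ.≤? q)

*-bitℚ≤*-bitℚ-argmax : ∀ q b → q ℚ.* bitℚ b ℚ.≤ q ℚ.* bitℚ (argmax q)
*-bitℚ≤*-bitℚ-argmax q = go (0ℚ ℚ.≤? q)
  where
    go : (0≤?q : Dec (0ℚ ℚ.≤ q)) → ∀ b → q ℚ.* bitℚ b ℚ.≤ q ℚ.* bitℚ (does 0≤?q)
    go (yes 0≤q) false = subst₂ ℚ._≤_ (sym (ℚ.*-zeroʳ q)) (sym (ℚ.*-identityʳ q)) 0≤q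
    go (yes _)   true  = ℚ.≤-refl
    go (no  _)   false = ℚ.≤-refl
    go (no  0≰q) true  = subst₂ ℚ._≤_ (sym (ℚ.*-identityʳ q)) (sym (ℚ.*-zeroʳ q)) (ℚ.<⇒≤ (ℚ.≰⇒> 0≰q))

*-bitℚ-not-argmax≤ : ∀ q b → q ℚ.* bitℚ (not (argmax q)) ℚ.≤ q ℚ.* bitℚ b
*-bitℚ-not-argmax≤ q = go (0ℚ ℚ.≤? q)
  where
    go : (0≤?q : Dec (0ℚ ℚ.≤ q)) → ∀ b → q ℚ.* bitℚ (not (does 0≤?q)) ℚ.≤ q ℚ.* bitℚ b
    go (yes _)   false = ℚ.≤-refl
    go (yes 0≤q) true  = subst₂ ℚ._≤_ (sym (ℚ.*-zeroʳ q)) (sym (ℚ.*-identityʳ q)) 0≤q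
    go (no  0≰q) false = subst₂ ℚ._≤_ (sym (ℚ.*-identityʳ q)) (sym (ℚ.*-zeroʳ q)) (ℚ.<⇒≤ (ℚ.≰⇒> 0≰q))
    go (no  _)   true  = ℚ.≤-refl

maximiser minimiser : ∀ {n} → Vec ℚ n → Vec Bool n
maximiser w = map argmax w
minimiser w = map not (maximiser w)

ltf-mono : ∀ {n} {f : Vec Bool n → Bool} (ltf : IsLTF f) {a b} →
           dot (proj₁ ltf) a ℚ.≤ dot (proj₁ ltf) b → f a ≡ true → f b ≡ true
ltf-mono (w , t , f⇔) {a} {b} a≤b fa =
  Equivalence.from (f⇔ b) (ℚ.≤-trans (Equivalence.to (f⇔ a) fa) a≤b)

module _ {n k m : ℕ} (e : Fin n ↔ (Fin k × Fin m)) where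
  open Inverse e using (to)

  lookup-fill : ∀ c s x τ → IsCompletion e s x τ → ∀ i →
                lookup (fill e c s x) i ≡ lookup c i ⊎ lookup (fill e c s x) i ≡ lookup τ i
  lookup-fill c s x τ τ-completes i with proj₂ (to i) Fin.≟ lookup s (proj₁ (to i))
  ... | yes star    = inj₁ (fill-star e c s x star)
  ... | no  nonstar = inj₂ (trans (fill-isCompletion e c s x i nonstar) (sym (τ-completes i nonstar)))

  module _ (w : Vec ℚ n) where

    dot-≤-fill-maximiser : ∀ s x τ → IsCompletion e s x τ → dot w τ ℚ.≤ dot w (fill e (maximiser w) s x)
    dot-≤-fill-maximiser s x τ τ-completes = dot-mono w term≤
      where
        term≤ : ∀ i → lookup w i ℚ.* bitℚ (lookup τ i)
                        ℚ.≤ lookup w i ℚ.* bitℚ (lookup (fill e (maximiser w) s x) i)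
        term≤ i with lookup-fill (maximiser w) s x τ τ-completes i
        ... | inj₁ eq = subst (λ b → lookup w i ℚ.* bitℚ (lookup τ i) ℚ.≤ lookup w i ℚ.* bitℚ b)
                              (sym (trans eq (Vec.lookup-map i argmax w)))
                              (*-bitℚ≤*-bitℚ-argmax (lookup w i) (lookup τ i))
        ... | inj₂ eq = ℚ.≤-reflexive (cong (λ b → lookup w i ℚ.* bitℚ b) (sym eq))

    dot-fill-minimiser-≤ : ∀ s x τ → IsCompletion e s x τ → dot w (fill e (minimiser w) s x) ℚ.≤ dot w τ
    dot-fill-minimiser-≤ s x τ τ-completes = dot-mono w term≤
      where
        lookup-minimiser : ∀ i → lookup (minimiser w) i ≡ not (argmax (lookup w i))
        lookup-minimiser i = trans (Vec.lookup-map i not (maximiser w)) (cong not (Vec.lookup-map i argmax w))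
        term≤ : ∀ i → lookup w i ℚ.* bitℚ (lookup (fill e (minimiser w) s x) i)
                        ℚ.≤ lookup w i ℚ.* bitℚ (lookup τ i)
        term≤ i with lookup-fill (minimiser w) s x τ τ-completes i
        ... | inj₁ eq = subst (λ b → lookup w i ℚ.* bitℚ b ℚ.≤ lookup w i ℚ.* bitℚ (lookup τ i))
                              (sym (trans eq (lookup-minimiser i)))
                              (*-bitℚ-not-argmax≤ (lookup w i) (lookup τ i))
        ... | inj₂ eq = ℚ.≤-reflexive (cong (λ b → lookup w i ℚ.* bitℚ b) eq)

  samples : Enumeration (Vec (Fin m) k × Vec Bool n)
  samples = pairs (vecs (fins m) k) (vecs bools n)

  ∑-samples : ∀ (F : Vec (Fin m) k → Vec Bool n → ℕ) →
              ∑ (elements samples) (λ (s , x) → F s x) ≡ (∑[ s ∈ stars k ] ∑[ x ∈ bitVecs n ] F s x)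
  ∑-samples F = ∑-cartesianProductWith _,_ (stars k) (bitVecs n) (λ (s , x) → F s x)

  length-samples : length (elements samples) ≡ m ^ k * 2 ^ n
  length-samples = begin
    length (elements samples)
      ≡⟨ length-cartesianProductWith _,_ (stars k) (bitVecs n) ⟩
    length (stars k) * length (bitVecs n)
      ≡⟨ cong₂ _*_ (length-vecs (fins m) k) (length-vecs bools n) ⟩
    length (allFin m) ^ k * 2 ^ n
      ≡⟨ cong (λ l → l ^ k * 2 ^ n) (length-tabulate {n = m} (λ i → i)) ⟩
    m ^ k * 2 ^ n ∎
    where open ≡-Reasoning

  module _ {f : Vec Bool n → Bool} (ltf : IsLTF f) where

    private
      w = proj₁ ltf

    τ⁺ τ⁻ : Vec (Fin m) k → Vec Bool n → Vec Bool n
    τ⁺ = fill e (maximiser w)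
    τ⁻ = fill e (minimiser w)

    swing : Vec (Fin m) k × Vec Bool n → ℕ
    swing (s , x) = bit (f (τ⁺ s x)) ∸ bit (f (τ⁻ s x))

    notForced⇒1≤swing : ∀ s x → NotForced e f (s , x) → 1 ≤ swing (s , x)
    notForced⇒1≤swing s x notForced with f (τ⁻ s x) in f-τ⁻ | f (τ⁺ s x) in f-τ⁺
    ... | true  | _     = contradiction
      (true , λ τ τ-completes → ltf-mono ltf (dot-fill-minimiser-≤ w s x τ τ-completes) f-τ⁻) notForced
    ... | false | true  = s≤s z≤n
    ... | false | false = contradiction
      (false , λ τ τ-completes → Bool.¬-not λ fτ →
        true≢false (trans (sym (ltf-mono ltf (dot-≤-fill-maximiser w s x τ τ-completes) fτ)) f-τ⁺)) notForced
      where
        true≢false : true ≢ false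
        true≢false ()

    swing+bit-τ⁻ : ∀ s x → swing (s , x) + bit (f (τ⁻ s x)) ≡ bit (f (τ⁺ s x))
    swing+bit-τ⁻ s x with f (τ⁻ s x) in f-τ⁻
    ... | true
      rewrite ltf-mono ltf (dot-fill-minimiser-≤ w s x (τ⁺ s x) (fill-isCompletion e (maximiser w) s x)) f-τ⁻
      = refl
    ... | false = +-identityʳ _

    module _ {N : ℕ} (size : HasSize (NotForced e f) N) where

      private
        L = proj₁ size
        L-unique = proj₁ (proj₂ size)
        ∈L⇔notForced = proj₁ (proj₂ (proj₂ size))
        length-L = proj₂ (proj₂ (proj₂ size))

      count≤∑ : ∀ Q → (∀ s x → NotForced e f (s , x) → 1 ≤ Q (s , x)) → N ≤ ∑ (elements samples) Q
      count≤∑ Q 1≤Q = subst (_≤ ∑ (elements samples) Q) length-L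
        (length-unique≤∑ samples L L-unique Q λ (s , x) ∈L →
           1≤Q s x (Equivalence.to (∈L⇔notForced (s , x)) ∈L))

      count≤samples : N ≤ m ^ k * 2 ^ n
      count≤samples = begin
        N                                ≤⟨ count≤∑ (const 1) (λ _ _ _ → ≤-refl) ⟩
        ∑ (elements samples) (const 1)   ≡⟨ ∑-const (elements samples) 1 ⟩
        length (elements samples) * 1   ≡⟨ trans (*-identityʳ _) length-samples ⟩
        m ^ k * 2 ^ n                    ∎
        where open ≤-Reasoning

      private
        D = toBlocks e (maximiser w)
        g : Vec (Vec Bool m) k → ℕ
        g y = bit (f (fromBlocks e y))
        Δ : Vec (Vec Bool m) k → ℕ
        Δ y = ∣ A⁺ D y - A⁻ D y ∣
        S⁺ = ∑[ y ∈ blocks k ] A⁺ D y * g y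
        S⁻ = ∑[ y ∈ blocks k ] A⁻ D y * g y
        R = ∑ (elements samples) swing

        ∑-bit-fill : ∀ c → ∑ (elements samples) (λ (s , x) → bit (f (fill e c s x)))
                           ≡ 2 ^ k * (∑[ y ∈ blocks k ] blockProduct agreements (toBlocks e c) y * g y)
        ∑-bit-fill c = trans (∑-samples λ s x → bit (f (fill e c s x))) (∑-fill e c (bit ∘ f))

        R+2^k*S⁻≡2^k*S⁺ : R + 2 ^ k * S⁻ ≡ 2 ^ k * S⁺
        R+2^k*S⁻≡2^k*S⁺ = begin
          R + 2 ^ k * S⁻
            ≡⟨ cong (λ ds → R + 2 ^ k * (∑[ y ∈ blocks k ] blockProduct agreements ds y * g y))
                    (sym (toBlocks-map e not (maximiser w))) ⟩
          R + 2 ^ k * (∑[ y ∈ blocks k ] blockProduct agreements (toBlocks e (minimiser w)) y * g y)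
            ≡⟨ cong (R +_) (sym (∑-bit-fill (minimiser w))) ⟩
          R + ∑ (elements samples) (λ (s , x) → bit (f (τ⁻ s x)))
            ≡⟨ sym (∑-distrib-+ (elements samples) swing _) ⟩
          ∑ (elements samples) (λ (s , x) → swing (s , x) + bit (f (τ⁻ s x)))
            ≡⟨ ∑-cong (elements samples) (λ (s , x) → swing+bit-τ⁻ s x) ⟩
          ∑ (elements samples) (λ (s , x) → bit (f (τ⁺ s x)))
            ≡⟨ ∑-bit-fill (maximiser w) ⟩
          2 ^ k * S⁺ ∎
          where open ≡-Reasoning

        R≤2^k*∑Δ : R ≤ 2 ^ k * ∑ (blocks k) Δ
        R≤2^k*∑Δ = +-cancelʳ-≤ (2 ^ k * S⁻) R (2 ^ k * ∑ (blocks k) Δ) (begin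
          R + 2 ^ k * S⁻
            ≡⟨ R+2^k*S⁻≡2^k*S⁺ ⟩
          2 ^ k * S⁺
            ≤⟨ *-monoʳ-≤ (2 ^ k) (∑-mono (blocks k) λ y → m*bit≤n*bit+∣m-n∣ (A⁺ D y) (A⁻ D y) (f (fromBlocks e y))) ⟩
          2 ^ k * (∑[ y ∈ blocks k ] A⁻ D y * g y + Δ y)
            ≡⟨ cong (2 ^ k *_) (∑-distrib-+ (blocks k) (λ y → A⁻ D y * g y) Δ) ⟩
          2 ^ k * (S⁻ + ∑ (blocks k) Δ)
            ≡⟨ *-distribˡ-+ (2 ^ k) S⁻ (∑ (blocks k) Δ) ⟩
          2 ^ k * S⁻ + 2 ^ k * ∑ (blocks k) Δ
            ≡⟨ +-comm (2 ^ k * S⁻) (2 ^ k * ∑ (blocks k) Δ) ⟩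
          2 ^ k * ∑ (blocks k) Δ + 2 ^ k * S⁻ ∎)
          where open ≤-Reasoning

      count²≤ : N * N ≤ (2 ^ m) ^ k * (4 ^ k * (∑[ y ∈ blocks k ] Δ y * Δ y))
      count²≤ = begin
        N * N                                      ≤⟨ *-mono-≤ N≤2^k*Z N≤2^k*Z ⟩
        (2 ^ k * Z) * (2 ^ k * Z)                  ≡⟨ regroup (2 ^ k) Z ⟩
        (2 ^ k * 2 ^ k) * (Z * Z)                  ≡⟨ cong (_* (Z * Z)) (sym (^-distribʳ-* 2 2 k)) ⟩
        4 ^ k * (Z * Z)                            ≤⟨ *-monoʳ-≤ (4 ^ k) Z²≤ ⟩
        4 ^ k * ((2 ^ m) ^ k * Δ²)                 ≡⟨ *-comm-left (4 ^ k) ((2 ^ m) ^ k) Δ² ⟩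
        (2 ^ m) ^ k * (4 ^ k * Δ²)                 ∎
        where
          open ≤-Reasoning
          Z = ∑ (blocks k) Δ
          Δ² = ∑[ y ∈ blocks k ] Δ y * Δ y
          N≤2^k*Z : N ≤ 2 ^ k * Z
          N≤2^k*Z = ≤-trans (count≤∑ swing notForced⇒1≤swing) R≤2^k*∑Δ
          Z²≤ : Z * Z ≤ (2 ^ m) ^ k * Δ²
          Z²≤ = subst (λ l → Z * Z ≤ l * Δ²) (length-blocks k) (∑-Cauchy-Schwarz (blocks k) Δ)
          regroup : ∀ a z → (a * z) * (a * z) ≡ (a * a) * (z * z)
          regroup = solve-∀
          *-comm-left : ∀ a b c → a * (b * c) ≡ b * (a * c)
          *-comm-left = solve-∀

module _ (k′ m′ : ℕ) where

  private
    k = suc k′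
    M = suc m′
    P = (2 ^ M) ^ k
    T = M ^ k * P

  moment-bound : ∀ V → 2 * k′ ≤ M → V + 2 * (2 ^ M * (M * m′)) ^ k ≡ 2 * (2 ^ M * (M * suc M)) ^ k →
                 V ≤ 8 * k * (P * (M ^ k * M ^ k′))
  moment-bound V 2k′≤M V-identity = +-cancelʳ-≤ (2 * (P * (M ^ k * m′ ^ k))) V _ (begin
    V + 2 * (P * (M ^ k * m′ ^ k))
      ≡⟨ cong (λ a → V + 2 * a) (sym (distribute-pow m′)) ⟩
    V + 2 * (2 ^ M * (M * m′)) ^ k
      ≡⟨ V-identity ⟩
    2 * (2 ^ M * (M * suc M)) ^ k
      ≡⟨ cong (2 *_) (distribute-pow (suc M)) ⟩
    2 * (P * (M ^ k * suc M ^ k))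
      ≤⟨ *-monoʳ-≤ 2 (*-monoʳ-≤ P (*-monoʳ-≤ (M ^ k) (pow-gap m′ k′ 2k′≤M))) ⟩
    2 * (P * (M ^ k * (m′ ^ k + 4 * k * M ^ k′)))
      ≡⟨ expand P (M ^ k) (m′ ^ k) k (M ^ k′) ⟩
    8 * k * (P * (M ^ k * M ^ k′)) + 2 * (P * (M ^ k * m′ ^ k)) ∎)
    where
      open ≤-Reasoning
      distribute-pow : ∀ a → (2 ^ M * (M * a)) ^ k ≡ P * (M ^ k * a ^ k)
      distribute-pow a = trans (^-distribʳ-* (2 ^ M) (M * a) k) (cong (P *_) (^-distribʳ-* M a k))
      expand : ∀ P Mk mk k X →
               2 * (P * (Mk * (mk + 4 * k * X))) ≡ 8 * k * (P * (Mk * X)) + 2 * (P * (Mk * mk))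
      expand = solve-∀

  square-bound-arithmetic : ∀ N V → N ≤ T → N * N ≤ P * V →
    V + 2 * (2 ^ M * (M * m′)) ^ k ≡ 2 * (2 ^ M * (M * suc M)) ^ k →
    N * N * (k * M) ≤ 3 * 3 * (k * k) * (T * T)
  square-bound-arithmetic N V N≤T N²≤PV V-identity with 2 * k′ ≤? M
  ... | yes 2k′≤M = begin
    N * N * (k * M)
      ≤⟨ *-monoˡ-≤ (k * M) (≤-trans N²≤PV (*-monoʳ-≤ P (moment-bound V 2k′≤M V-identity))) ⟩
    P * (8 * k * (P * (M ^ k * M ^ k′))) * (k * M)
      ≡⟨ regroup P k M (M ^ k′) ⟩
    8 * (k * k) * (M ^ k * P * (M ^ k * P))
      ≤⟨ *-monoˡ-≤ (T * T) (*-monoˡ-≤ (k * k) (n≤1+n 8)) ⟩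
    3 * 3 * (k * k) * (T * T) ∎
    where
      open ≤-Reasoning
      regroup : ∀ P k M X → P * (8 * k * (P * ((M * X) * X))) * (k * M)
                            ≡ 8 * (k * k) * ((M * X) * P * ((M * X) * P))
      regroup = solve-∀
  ... | no 2k′≰M = begin
    N * N * (k * M)
      ≤⟨ *-mono-≤ (*-mono-≤ N≤T N≤T) (*-monoʳ-≤ k M≤2k) ⟩
    T * T * (k * (2 * k))
      ≡⟨ regroup T k ⟩
    2 * (k * k) * (T * T)
      ≤⟨ *-monoˡ-≤ (T * T) (*-monoˡ-≤ (k * k) {2} {9} (s≤s (s≤s z≤n))) ⟩
    3 * 3 * (k * k) * (T * T) ∎
    where
      open ≤-Reasoning
      M≤2k : M ≤ 2 * k
      M≤2k = ≤-trans (<⇒≤ (≰⇒> 2k′≰M)) (*-monoʳ-≤ 2 (n≤1+n k′))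
      regroup : ∀ T k → T * T * (k * (2 * k)) ≡ 2 * (k * k) * (T * T)
      regroup = solve-∀

not-forced-count-bound : ∀ (n k m : ℕ) → 1 ≤ m → (e : Fin n ↔ (Fin k × Fin m)) →
  (f : Vec Bool n → Bool) → IsLTF f →
  (N : ℕ) → HasSize (NotForced e f) N →
  N * N * n ≤ 3 * 3 * (k * k) * ((m ^ k * 2 ^ n) * (m ^ k * 2 ^ n))
not-forced-count-bound n zero     m        _ e f _ N _ =
  ≤-trans (≤-reflexive (trans (cong (N * N *_) (n≡k*m e)) (*-zeroʳ (N * N)))) z≤n
not-forced-count-bound n (suc k′) zero     ()
not-forced-count-bound n (suc k′) (suc m′) _ e f ltf N size =
  subst₂ (λ n′ P → N * N * n′ ≤ 3 * 3 * (k * k) * ((M ^ k * P) * (M ^ k * P)))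
         (sym (n≡k*m e)) (sym 2^n≡P)
    (square-bound-arithmetic k′ m′ N _
      (subst (λ P → N ≤ M ^ k * P) 2^n≡P (count≤samples e ltf size))
      (count²≤ e ltf size)
      (∑-blockProduct-gap² (toBlocks e (maximiser (proj₁ ltf)))))
  where
    k = suc k′
    M = suc m′
    2^n≡P : 2 ^ n ≡ (2 ^ M) ^ k
    2^n≡P = 2^n≡[2^m]^k e

lemma1p6 : Σ ℕ λ C →
  ∀ (n k m : ℕ) → 1 ≤ m → (e : Fin n ↔ (Fin k × Fin m)) →
  (f : Vec Bool n → Bool) → IsLTF f →
  (N : ℕ) → HasSize (NotForced e f) N →
  N * N * n ≤ C * C * (k * k) * ((m ^ k * 2 ^ n) * (m ^ k * 2 ^ n))
lemma1p6 = 3 , not-forced-count-bound
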